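{- There exist two transversal designs $(V,\mathcal{G},\mathcal{B}^{\dagger})$ and $(V,\mathcal{G},\mathcal{B})$ with group size $3$ and block size $3$ having the same point set and the same group set such that (1) there are two distinct points $x,y \in V$ such that every block which is in $\mathcal{B}$ but not in $\mathcal{B}^{\dagger}$ contains either $x$ or $y$; and (2) there is a partition $\{S_1,S_2,S_3\}$ of $V$ such that (i) $|S_i \cap G|=1$ for all $i \in \{1,2,3\}$ and $G \in \mathcal{G}$; (ii) $\{S_1,S_2,S_3\}$ is a blocking system for $(V,\mathcal{B}^{\dagger})$; and (iii) $S_1 \in \mathcal{B}$.
   Context: A transversal design with group size $g$ and block size $k$ is a triple $(V,\mathcal{G},\mathcal{B})$ where $\mathcal{G}$ is a partition of $V$ into $k$ groups each of size $g$ and $\mathcal{B}$ is a collection of $k$-subsets of $V$ (blocks) such that each pair of points in different groups lies in exactly one block and no pair in the same group lies in any block. A blocking system for $(V,\mathcal{B})$ is a collection of pairwise disjoint subsets of $V$ such that every block meets at least two of them. -}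

module Defs where

open import Data.Nat using (ℕ)
open import Data.Fin using (Fin)
open import Data.Fin.Subset using (Subset; _∈_; _∩_; ∣_∣; Nonempty; Empty)
open import Data.Fin.Subset.Properties using (_∈?_)
open import Data.List using (List; length; filter)
import Data.List.Membership.Propositional as L
open import Data.Product using (Σ; ∃; ∃-syntax; _×_)
open import Relation.Nullary using (¬_)
open import Relation.Nullary.Decidable using (_×-dec_)
open import Relation.Binary.PropositionalEquality using (_≡_; _≢_)

-- Point set V is Fin n; a (multi)collection of subsets is a List (Subset n).

pairCount : ∀ {n} → Fin n → Fin n → List (Subset n) → ℕ
pairCount x y Bs = length (filter (λ B → (x ∈? B) ×-dec (y ∈? B)) Bs)

pointCount : ∀ {n} → Fin n → List (Subset n) → ℕ
pointCount x Gs = length (filter (λ G → x ∈? G) Gs)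

SameGroup : ∀ {n} → List (Subset n) → Fin n → Fin n → Set
SameGroup Gs x y = ∃[ G ] (G L.∈ Gs × x ∈ G × y ∈ G)

record IsTD (g k n : ℕ) (Gs Bs : List (Subset n)) : Set where
  field
    numGroups  : length Gs ≡ k
    groupSize  : ∀ G → G L.∈ Gs → ∣ G ∣ ≡ g
    partition  : ∀ x → pointCount x Gs ≡ 1
    blockSize  : ∀ B → B L.∈ Bs → ∣ B ∣ ≡ k
    crossPairs : ∀ x y → x ≢ y → ¬ SameGroup Gs x y → pairCount x y Bs ≡ 1
    groupPairs : ∀ x y → x ≢ y → SameGroup Gs x y → pairCount x y Bs ≡ 0

IsPartition3 : ∀ {n} → (Fin 3 → Subset n) → Set
IsPartition3 {n} S =
  (∀ i → Nonempty (S i)) ×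
  (∀ i j → i ≢ j → Empty (S i ∩ S j)) ×
  (∀ (x : Fin n) → ∃[ i ] (x ∈ S i))

IsBlockingSystem3 : ∀ {n} → (Fin 3 → Subset n) → List (Subset n) → Set
IsBlockingSystem3 S Bs =
  (∀ i j → i ≢ j → Empty (S i ∩ S j)) ×
  (∀ B → B L.∈ Bs → ∃[ i ] ∃[ j ] (i ≢ j × Nonempty (S i ∩ B) × Nonempty (S j ∩ B)))

-- A TD(3,3) on the groups {0,1,2}, {3,4,5}, {6,7,8} is a Latin square of order 3: the block
-- {a, 3+b, 6+c} records the entry c in cell (a, b).  B† comes from the cyclic square
-- c = a + b, and B from it by exchanging rows 0 and 1, so the changed blocks all pass through
-- 0 or 1.  The parts S₁ = {0,3,7}, S₂ = {1,4,6}, S₃ = {2,5,8} are transversals of the groups,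
-- hence a block of B† meets only one part exactly when it equals that part; none of them is a
-- block of B†, while S₁ is a block of B.
module Submission where

open import Defs
open import Data.Nat using (ℕ)
open import Data.Fin using (Fin; zero)
open import Data.Fin.Subset using (Subset; _∈_; _∩_; ∣_∣)
import Data.List.Membership.Propositional as L
open import Data.List using (List)
open import Data.Product using (Σ; ∃; ∃-syntax; _×_)
open import Data.Sum using (_⊎_)
open import Relation.Nullary using (¬_)
open import Relation.Binary.PropositionalEquality using (_≡_; _≢_)

open import Data.Bool using () renaming (_≟_ to _≟ᵇ_)
open import Data.Nat using () renaming (_≟_ to _≟ℕ_)
open import Data.Fin using (suc; #_) renaming (_≟_ to _≟ᶠ_)
open import Data.Fin.Properties using (all?; any?)
open import Data.Fin.Subset using (⁅_⁆; _∪_)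
open import Data.Fin.Subset.Properties using (_∈?_; nonempty?)
open import Data.List using ([]; _∷_; length)
open import Data.List.Relation.Unary.Any as Any using (here)
open import Data.List.Relation.Unary.All as All using ()
import Data.List.Membership.DecPropositional as DecMembership
open import Data.Product using (_,_)
open import Data.Vec.Properties using (≡-dec)
open import Relation.Binary.PropositionalEquality using (refl)
open import Relation.Nullary using (Dec)
open import Relation.Nullary.Decidable using (map′; from-yes; ¬?; _×-dec_; _⊎-dec_; _→-dec_)

module _ {n : ℕ} where

  _∈ᴸ?_ : (B : Subset n) (Bs : List (Subset n)) → Dec (B L.∈ Bs)
  _∈ᴸ?_ = DecMembership._∈?_ (≡-dec _≟ᵇ_)

  ∀∈? : {P : Subset n → Set} (Bs : List (Subset n)) →
        (∀ B → Dec (P B)) → Dec (∀ B → B L.∈ Bs → P B)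
  ∀∈? Bs P? = map′ (λ all _ → All.lookup all) (λ f → All.tabulate (f _)) (All.all? P? Bs)

  sameGroup? : (Gs : List (Subset n)) (x y : Fin n) → Dec (SameGroup Gs x y)
  sameGroup? Gs x y =
    map′ L.find (λ (G , G∈Gs , x∈G , y∈G) → L.lose G∈Gs (x∈G , y∈G))
         (Any.any? (λ G → x ∈? G ×-dec y ∈? G) Gs)

  isTD? : (g k : ℕ) (Gs Bs : List (Subset n)) → Dec (IsTD g k n Gs Bs)
  isTD? g k Gs Bs = map′
    (λ (numGroups , groupSize , partition , blockSize , crossPairs , groupPairs) → record
       { numGroups = numGroups ; groupSize = groupSize ; partition = partition
       ; blockSize = blockSize ; crossPairs = crossPairs ; groupPairs = groupPairs })
    (λ td → let open IsTD td in
       numGroups , groupSize , partition , blockSize , crossPairs , groupPairs)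
    (length Gs ≟ℕ k
     ×-dec ∀∈? Gs (λ G → ∣ G ∣ ≟ℕ g)
     ×-dec all? (λ x → pointCount x Gs ≟ℕ 1)
     ×-dec ∀∈? Bs (λ B → ∣ B ∣ ≟ℕ k)
     ×-dec all? (λ x → all? λ y →
             ¬? (x ≟ᶠ y) →-dec ¬? (sameGroup? Gs x y) →-dec pairCount x y Bs ≟ℕ 1)
     ×-dec all? (λ x → all? λ y →
             ¬? (x ≟ᶠ y) →-dec sameGroup? Gs x y →-dec pairCount x y Bs ≟ℕ 0))

  isPartition3? : (S : Fin 3 → Subset n) → Dec (IsPartition3 S)
  isPartition3? S =
    all? (λ i → nonempty? (S i))
    ×-dec all? (λ i → all? λ j → ¬? (i ≟ᶠ j) →-dec ¬? (nonempty? (S i ∩ S j)))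
    ×-dec all? (λ x → any? λ i → x ∈? S i)

  isBlockingSystem3? : (S : Fin 3 → Subset n) (Bs : List (Subset n)) →
                       Dec (IsBlockingSystem3 S Bs)
  isBlockingSystem3? S Bs =
    all? (λ i → all? λ j → ¬? (i ≟ᶠ j) →-dec ¬? (nonempty? (S i ∩ S j)))
    ×-dec ∀∈? Bs (λ B → any? λ i → any? λ j →
            ¬? (i ≟ᶠ j) ×-dec nonempty? (S i ∩ B) ×-dec nonempty? (S j ∩ B))

  meetsEachGroupOnce? : (S : Fin 3 → Subset n) (Gs : List (Subset n)) →
                        Dec (∀ i G → G L.∈ Gs → ∣ S i ∩ G ∣ ≡ 1)
  meetsEachGroupOnce? S Gs = all? (λ i → ∀∈? Gs (λ G → ∣ S i ∩ G ∣ ≟ℕ 1))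

  changedBlocksThrough? : (x y : Fin n) (B† Bs : List (Subset n)) →
                          Dec (∀ B → B L.∈ Bs → ¬ (B L.∈ B†) → x ∈ B ⊎ y ∈ B)
  changedBlocksThrough? x y B† Bs =
    ∀∈? Bs (λ B → ¬? (B ∈ᴸ? B†) →-dec (x ∈? B ⊎-dec y ∈? B))

triple : Fin 9 → Fin 9 → Fin 9 → Subset 9
triple a b c = ⁅ a ⁆ ∪ ⁅ b ⁆ ∪ ⁅ c ⁆

groups : List (Subset 9)
groups = triple (# 0) (# 1) (# 2) ∷ triple (# 3) (# 4) (# 5) ∷ triple (# 6) (# 7) (# 8) ∷ []

cyclicBlocks : List (Subset 9)
cyclicBlocks =
  triple (# 0) (# 3) (# 6) ∷ triple (# 0) (# 4) (# 7) ∷ triple (# 0) (# 5) (# 8) ∷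
  triple (# 1) (# 3) (# 7) ∷ triple (# 1) (# 4) (# 8) ∷ triple (# 1) (# 5) (# 6) ∷
  triple (# 2) (# 3) (# 8) ∷ triple (# 2) (# 4) (# 6) ∷ triple (# 2) (# 5) (# 7) ∷ []

swappedBlocks : List (Subset 9)
swappedBlocks =
  triple (# 0) (# 3) (# 7) ∷ triple (# 0) (# 4) (# 8) ∷ triple (# 0) (# 5) (# 6) ∷
  triple (# 1) (# 3) (# 6) ∷ triple (# 1) (# 4) (# 7) ∷ triple (# 1) (# 5) (# 8) ∷
  triple (# 2) (# 3) (# 8) ∷ triple (# 2) (# 4) (# 6) ∷ triple (# 2) (# 5) (# 7) ∷ []

parts : Fin 3 → Subset 9
parts zero             = triple (# 0) (# 3) (# 7)
parts (suc zero)       = triple (# 1) (# 4) (# 6)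
parts (suc (suc zero)) = triple (# 2) (# 5) (# 8)

lemma6p1 : ∃[ n ] ∃[ Gs ] ∃[ Bd ] ∃[ Bs ]
    (IsTD 3 3 n Gs Bd × IsTD 3 3 n Gs Bs
    × (∃[ x ] ∃[ y ] (x ≢ y × (∀ B → B L.∈ Bs → ¬ (B L.∈ Bd) → x ∈ B ⊎ y ∈ B)))
    × (∃[ S ] (IsPartition3 {n} S
        × (∀ i G → G L.∈ Gs → ∣ S i ∩ G ∣ ≡ 1)
        × IsBlockingSystem3 S Bd
        × S zero L.∈ Bs)))
lemma6p1 =
  9 , groups , cyclicBlocks , swappedBlocks
  , from-yes (isTD? 3 3 groups cyclicBlocks)
  , from-yes (isTD? 3 3 groups swappedBlocks)
  , (# 0 , # 1 , (λ ()) , from-yes (changedBlocksThrough? (# 0) (# 1) cyclicBlocks swappedBlocks))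
  , ( parts
    , from-yes (isPartition3? parts)
    , from-yes (meetsEachGroupOnce? parts groups)
    , from-yes (isBlockingSystem3? parts cyclicBlocks)
    , here refl )
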